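{- Let $\beta,\gamma$ be beta-sets with $\beta\subsetneq\gamma$ and $\beta\prec\gamma$, and let $k=\min(\gamma\setminus\beta)$. Then $\beta\cup\{k\}\prec\gamma$.
   Context: A beta-set is a finite set of positive integers written decreasingly $\{\beta_1>\dots>\beta_n\}$, with associated partition $P(\beta)=(\beta_1-(n-1),\dots,\beta_n)$. For partitions $P=(P_1,\dots,P_n)$, $Q=(Q_1,\dots,Q_m)$ write $P<Q$ if $n\le m$ and $P_i\le Q_i$ for $i\le n$; for beta-sets $\beta\prec\gamma$ means $P(\beta)<P(\gamma)$. -}

module Defs where

open import Data.Nat using (ℕ; _≤_; _<_; _>_; _∸_)
open import Data.List using (List; []; _∷_; length)
open import Data.List.Relation.Unary.All using (All)
open import Data.List.Relation.Unary.Linked using (Linked)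
open import Data.List.Relation.Binary.Pointwise using (Pointwise)
open import Data.List.Membership.Propositional using (_∈_)
open import Data.Product using (_×_; Σ; ∃)
open import Data.Sum using (_⊎_)
open import Relation.Binary.PropositionalEquality using (_≡_)
open import Relation.Nullary using (¬_)

-- A beta-set {β₁ > … > βₙ} is represented by the list [β₁, …, βₙ]:
-- strictly decreasing, all entries positive.
IsBetaSet : List ℕ → Set
IsBetaSet b = Linked _>_ b × All (λ x → 0 < x) b

record BetaSet : Set where
  constructor mkBeta
  field
    elems   : List ℕ
    isBeta  : IsBetaSet elems
open BetaSet public

partitionL : List ℕ → List ℕ
partitionL []       = []
partitionL (b ∷ bs) = (b ∸ length bs) ∷ partitionL bs

P : BetaSet → List ℕ
P β = partitionL (elems β)

data _<ᴾ_ : List ℕ → List ℕ → Set where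
  []<  : ∀ {Q} → [] <ᴾ Q
  ∷<   : ∀ {p q P Q} → p ≤ q → P <ᴾ Q → (p ∷ P) <ᴾ (q ∷ Q)

_≺_ : BetaSet → BetaSet → Set
β ≺ γ = P β <ᴾ P γ

_∈β_ : ℕ → BetaSet → Set
x ∈β β = x ∈ elems β

_⊆β_ : BetaSet → BetaSet → Set
β ⊆β γ = ∀ {x} → x ∈β β → x ∈β γ

_⊊β_ : BetaSet → BetaSet → Set
β ⊊β γ = β ⊆β γ × ∃ λ x → x ∈β γ × ¬ (x ∈β β)

IsMinDiff : ℕ → BetaSet → BetaSet → Set
IsMinDiff k γ β = (k ∈β γ × ¬ (k ∈β β)) × (∀ x → x ∈β γ → ¬ (x ∈β β) → k ≤ x)

IsUnionSingleton : BetaSet → BetaSet → ℕ → Set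
IsUnionSingleton δ β k = ∀ x → (x ∈β δ → (x ∈β β ⊎ x ≡ k)) × ((x ∈β β ⊎ x ≡ k) → x ∈β δ)

-- Cut every beta-set at k into its elements above k and those at most k.  By the
-- minimality of k, γ and β ∪ {k} agree at most k, and β and β ∪ {k} agree above k, so
-- β = H ++ T, β ∪ {k} = H ++ L and γ = G ++ L with |H| ≤ |G| and |T| ≤ |L|.  Replacing
-- the suffix T by the longer L only lowers the parts of P coming from H, and the
-- remaining parts P(L) form a suffix of the weakly decreasing P(γ), which dominates
-- it entrywise.
module Submission where

open import Defs
open import Data.Nat using (ℕ; suc; _≤_; _<_; _>_; _≥_; z≤n; s≤s; _<?_; _≤?_; _≟_)
open import Data.Nat.Properties
open import Data.List using (List; []; _∷_; length; _++_; filter)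
open import Data.List.Properties using (length-++; filter-accept; filter-reject; filter-all; filter-none)
open import Data.List.Relation.Unary.All as All using (All; []; _∷_)
open import Data.List.Relation.Unary.AllPairs as AllPairs using (AllPairs; []; _∷_)
import Data.List.Relation.Unary.AllPairs.Properties as AllPairs
open import Data.List.Relation.Unary.Linked as Linked using (Linked; []; [-]; _∷_)
open import Data.List.Relation.Unary.Linked.Properties using (Linked⇒AllPairs)
open import Data.List.Relation.Unary.Any using (here; there)
open import Data.List.Membership.Propositional using (_∈_)
open import Data.List.Membership.Propositional.Properties using (∈-filter⁺; ∈-filter⁻)
open import Data.List.Relation.Binary.Subset.Propositional using (_⊆_)
open import Data.List.Relation.Binary.Subset.Propositional.Properties using (filter⁺′)
open import Data.Product using (_,_; proj₁; proj₂)
open import Data.Sum using (inj₁; inj₂)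
open import Function using (_on_; id)
open import Relation.Nullary using (Dec; yes; no; ¬_; contradiction)
open import Relation.Nullary.Decidable using (decidable-stable)
open import Data.List.Membership.DecPropositional _≟_ using (_∈?_)
open import Relation.Binary.PropositionalEquality

StrictlyDecreasing : List ℕ → Set
StrictlyDecreasing = AllPairs _>_

linked⇒strictlyDecreasing : ∀ {xs} → Linked _>_ xs → StrictlyDecreasing xs
linked⇒strictlyDecreasing = Linked⇒AllPairs (λ x>y y>z → <-trans y>z x>y)

≤-head : ∀ {y ys z} → StrictlyDecreasing (y ∷ ys) → z ∈ y ∷ ys → z ≤ y
≤-head _          (here refl) = ≤-refl
≤-head (y>ys ∷ _) (there z∈ys) = <⇒≤ (All.lookup y>ys z∈ys)

<-head⇒∈-tail : ∀ {x xs z} → z < x → z ∈ x ∷ xs → z ∈ xs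
<-head⇒∈-tail z<x (here refl) = contradiction z<x (<-irrefl refl)
<-head⇒∈-tail _   (there z∈xs) = z∈xs

strictlyDecreasing-ext : ∀ {xs ys} → StrictlyDecreasing xs → StrictlyDecreasing ys →
  xs ⊆ ys → ys ⊆ xs → xs ≡ ys
strictlyDecreasing-ext [] [] _ _ = refl
strictlyDecreasing-ext [] (_ ∷ _) _ ys⊆xs with () ← ys⊆xs (here refl)
strictlyDecreasing-ext (_ ∷ _) [] xs⊆ys _ with () ← xs⊆ys (here refl)
strictlyDecreasing-ext {x ∷ xs} {y ∷ ys} sx@(x>xs ∷ sxs) sy@(y>ys ∷ sys) xs⊆ys ys⊆xs
  with ≤-antisym (≤-head sy (xs⊆ys (here refl))) (≤-head sx (ys⊆xs (here refl)))
... | refl = cong (x ∷_) (strictlyDecreasing-ext sxs sys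
  (λ z∈xs → <-head⇒∈-tail (All.lookup x>xs z∈xs) (xs⊆ys (there z∈xs)))
  (λ z∈ys → <-head⇒∈-tail (All.lookup y>ys z∈ys) (ys⊆xs (there z∈ys))))

⊆⇒length≤ : ∀ {xs ys} → StrictlyDecreasing xs → StrictlyDecreasing ys →
  xs ⊆ ys → length xs ≤ length ys
⊆⇒length≤ [] _ _ = z≤n
⊆⇒length≤ (_ ∷ _) [] xs⊆ys with () ← xs⊆ys (here refl)
⊆⇒length≤ {x ∷ xs} sx@(x>xs ∷ sxs) (y>ys ∷ sys) xs⊆ys with xs⊆ys (here refl)
... | here refl = s≤s (⊆⇒length≤ sxs sys
  (λ z∈xs → <-head⇒∈-tail (All.lookup x>xs z∈xs) (xs⊆ys (there z∈xs))))
... | there x∈ys = m≤n⇒m≤1+n (⊆⇒length≤ sx sys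
  (λ z∈x∷xs → <-head⇒∈-tail (≤-<-trans (≤-head sx z∈x∷xs) (All.lookup y>ys x∈ys)) (xs⊆ys z∈x∷xs)))

above atMost : ℕ → List ℕ → List ℕ
above  k = filter (k <?_)
atMost k = filter (_≤? k)

above++atMost : ∀ k {xs} → StrictlyDecreasing xs → above k xs ++ atMost k xs ≡ xs
above++atMost k {[]} [] = refl
above++atMost k {x ∷ xs} (x>xs ∷ sxs) with k <? x
... | yes k<x = begin
  above k (x ∷ xs) ++ atMost k (x ∷ xs) ≡⟨ cong₂ _++_ (filter-accept (k <?_) k<x) (filter-reject (_≤? k) (<⇒≱ k<x)) ⟩
  x ∷ above k xs ++ atMost k xs         ≡⟨ cong (x ∷_) (above++atMost k sxs) ⟩
  x ∷ xs                                ∎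
  where open ≡-Reasoning
... | no k≮x = begin
  above k (x ∷ xs) ++ atMost k (x ∷ xs) ≡⟨ cong₂ _++_ (filter-none (k <?_) (All.map ≤⇒≯ x∷xs≤k)) (filter-all (_≤? k) x∷xs≤k) ⟩
  x ∷ xs                                ∎
  where open ≡-Reasoning
        x≤k : x ≤ k
        x≤k = ≮⇒≥ k≮x
        x∷xs≤k : All (_≤ k) (x ∷ xs)
        x∷xs≤k = x≤k ∷ All.map (λ z<x → ≤-trans (<⇒≤ z<x) x≤k) x>xs

module _ {P : ℕ → Set} (P? : ∀ z → Dec (P z)) where

  filter-cong-∈ : ∀ {xs ys} → StrictlyDecreasing xs → StrictlyDecreasing ys →
    (∀ {z} → P z → z ∈ xs → z ∈ ys) → (∀ {z} → P z → z ∈ ys → z ∈ xs) →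
    filter P? xs ≡ filter P? ys
  filter-cong-∈ sxs sys xs⊆ys ys⊆xs = strictlyDecreasing-ext
    (AllPairs.filter⁺ P? sxs) (AllPairs.filter⁺ P? sys)
    (restrict xs⊆ys) (restrict ys⊆xs)
    where
    restrict : ∀ {xs ys} → (∀ {z} → P z → z ∈ xs → z ∈ ys) → filter P? xs ⊆ filter P? ys
    restrict xs⊆ys z∈ with z∈xs , Pz ← ∈-filter⁻ P? z∈ = ∈-filter⁺ P? (xs⊆ys Pz z∈xs) Pz

  length-filter-mono-⊆ : ∀ {xs ys} → StrictlyDecreasing xs → StrictlyDecreasing ys →
    xs ⊆ ys → length (filter P? xs) ≤ length (filter P? ys)
  length-filter-mono-⊆ sxs sys xs⊆ys =
    ⊆⇒length≤ (AllPairs.filter⁺ P? sxs) (AllPairs.filter⁺ P? sys) (filter⁺′ P? P? id xs⊆ys)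

<ᴾ-refl : ∀ Q → Q <ᴾ Q
<ᴾ-refl []      = []<
<ᴾ-refl (q ∷ Q) = ∷< ≤-refl (<ᴾ-refl Q)

<ᴾ-trans : ∀ {P Q R} → P <ᴾ Q → Q <ᴾ R → P <ᴾ R
<ᴾ-trans []<           _            = []<
<ᴾ-trans (∷< p≤q P<Q) (∷< q≤r Q<R) = ∷< (≤-trans p≤q q≤r) (<ᴾ-trans P<Q Q<R)

tail-<ᴾ : ∀ {q Q} → Linked _≥_ (q ∷ Q) → Q <ᴾ (q ∷ Q)
tail-<ᴾ [-]         = []<
tail-<ᴾ (q≥q′ ∷ Q≥) = ∷< q≥q′ (tail-<ᴾ Q≥)

partitionL-decreasing : ∀ {xs} → Linked _>_ xs → Linked _≥_ (partitionL xs)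
partitionL-decreasing []  = []
partitionL-decreasing [-] = [-]
partitionL-decreasing {x ∷ y ∷ ys} (x>y ∷ ys>) = ∸-monoˡ-≤ (suc (length ys)) x>y ∷ partitionL-decreasing ys>

partitionL-suffix : ∀ G {U} → Linked _>_ (G ++ U) → partitionL U <ᴾ partitionL (G ++ U)
partitionL-suffix []      _   = <ᴾ-refl _
partitionL-suffix (g ∷ G) G+U = <ᴾ-trans (partitionL-suffix G (Linked.tail G+U)) (tail-<ᴾ (partitionL-decreasing G+U))

partitionL-replace-suffix : ∀ A G {T U} → length A ≤ length G → length T ≤ length U →
  Linked _>_ (G ++ U) → partitionL (A ++ T) <ᴾ partitionL (G ++ U) → partitionL (A ++ U) <ᴾ partitionL (G ++ U)
partitionL-replace-suffix []      G       _         _   G+U _ = partitionL-suffix G G+U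
partitionL-replace-suffix (a ∷ A) (g ∷ G) {T} {U} (s≤s A≤G) T≤U G+U (∷< a∸≤g A+T<G+U) =
  ∷< (≤-trans (∸-monoʳ-≤ a A+T≤A+U) a∸≤g) (partitionL-replace-suffix A G A≤G T≤U (Linked.tail G+U) A+T<G+U)
  where
  A+T≤A+U : length (A ++ T) ≤ length (A ++ U)
  A+T≤A+U = subst₂ _≤_ (sym (length-++ A)) (sym (length-++ A)) (+-monoʳ-≤ (length A) T≤U)

elems-strictlyDecreasing : (α : BetaSet) → StrictlyDecreasing (elems α)
elems-strictlyDecreasing α = linked⇒strictlyDecreasing (proj₁ (isBeta α))

∪-min-diff-split : ∀ β γ k δ → β ⊆β γ → k ∈β γ → (∀ x → x ∈β γ → ¬ x ∈β β → k ≤ x) →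
  IsUnionSingleton δ β k → above k (elems β) ++ atMost k (elems γ) ≡ elems δ
∪-min-diff-split β γ k δ β⊆γ k∈γ k-min δ=β∪k = begin
  above k bs ++ atMost k gs ≡⟨ cong₂ _++_ (sym above-δ) (sym atMost-δ) ⟩
  above k ds ++ atMost k ds ≡⟨ above++atMost k (elems-strictlyDecreasing δ) ⟩
  ds                        ∎
  where
  open ≡-Reasoning
  bs gs ds : List ℕ
  bs = elems β
  gs = elems γ
  ds = elems δ

  above-δ : above k ds ≡ above k bs
  above-δ = filter-cong-∈ (k <?_) (elems-strictlyDecreasing δ) (elems-strictlyDecreasing β) δ⊆β β⊆δ
    where
    δ⊆β : ∀ {z} → k < z → z ∈ ds → z ∈ bs
    δ⊆β {z} k<z z∈δ with proj₁ (δ=β∪k z) z∈δ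
    ... | inj₁ z∈β  = z∈β
    ... | inj₂ refl = contradiction k<z (<-irrefl refl)
    β⊆δ : ∀ {z} → k < z → z ∈ bs → z ∈ ds
    β⊆δ {z} _ z∈β = proj₂ (δ=β∪k z) (inj₁ z∈β)

  atMost-δ : atMost k ds ≡ atMost k gs
  atMost-δ = filter-cong-∈ (_≤? k) (elems-strictlyDecreasing δ) (elems-strictlyDecreasing γ) δ⊆γ γ⊆δ
    where
    δ⊆γ : ∀ {z} → z ≤ k → z ∈ ds → z ∈ gs
    δ⊆γ {z} _ z∈δ with proj₁ (δ=β∪k z) z∈δ
    ... | inj₁ z∈β  = β⊆γ z∈β
    ... | inj₂ refl = k∈γ
    γ⊆δ : ∀ {z} → z ≤ k → z ∈ gs → z ∈ ds
    γ⊆δ {z} z≤k z∈γ with m≤n⇒m<n∨m≡n z≤k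
    ... | inj₁ z<k  = proj₂ (δ=β∪k z) (inj₁ (decidable-stable (z ∈? bs) (λ z∉β → <⇒≱ z<k (k-min z z∈γ z∉β))))
    ... | inj₂ refl = proj₂ (δ=β∪k z) (inj₂ refl)

lemma4p3 : (β γ : BetaSet) → β ⊊β γ → β ≺ γ → (k : ℕ) → IsMinDiff k γ β →
    (δ : BetaSet) → IsUnionSingleton δ β k → δ ≺ γ
lemma4p3 β γ (β⊆γ , _) β≺γ k ((k∈γ , _) , k-min) δ δ=β∪k =
  subst₂ (_<ᴾ_ on partitionL) (∪-min-diff-split β γ k δ β⊆γ k∈γ k-min δ=β∪k) γ-split
    (partitionL-replace-suffix (above k (elems β)) (above k (elems γ))
      (length-filter-mono-⊆ (k <?_) β↘ γ↘ β⊆γ) (length-filter-mono-⊆ (_≤? k) β↘ γ↘ β⊆γ)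
      (subst (Linked _>_) (sym γ-split) (proj₁ (isBeta γ)))
      (subst₂ (_<ᴾ_ on partitionL) (sym (above++atMost k β↘)) (sym γ-split) β≺γ))
  where
  β↘ : StrictlyDecreasing (elems β)
  β↘ = elems-strictlyDecreasing β
  γ↘ : StrictlyDecreasing (elems γ)
  γ↘ = elems-strictlyDecreasing γ
  γ-split : above k (elems γ) ++ atMost k (elems γ) ≡ elems γ
  γ-split = above++atMost k γ↘
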